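{- If $G$ is a finite simple graph with at least one edge, then there exists a minimum positive semidefinite zero forcing set $B$ for $G$ such that the first force of some forcing process starting from $B$ is a force $u\to w$ in which $w$ is the only white neighbor of $u$ in the whole graph $G$ (that is, the first force can be done without using the disconnect rule).
   Context: Positive semidefinite zero forcing on a graph $G$: an initial set $B$ of vertices is blue, the rest white. At each step, let $W_1,\dots,W_h$ be the vertex sets of the connected components of $G$ minus the current blue set; if a blue vertex $u$ has exactly one white neighbor $w$ in the subgraph induced by the blue vertices together with $W_i$ (for some $i$), then $u$ may force $w$, i.e. color $w$ blue. $B$ is a positive semidefinite zero forcing set if repeated application can make all vertices blue; it is minimum if it has minimum cardinality among such sets (this cardinality is $Z^+(G)$). -}

module Defs where

open import Data.Nat using (ℕ; _≤_)
open import Data.Bool using (Bool; true; false)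
open import Data.Fin using (Fin)
open import Data.Fin.Subset using (Subset; _∈_; _∉_; _∪_; ⁅_⁆; ∣_∣)
open import Data.Product using (Σ; _×_; ∃-syntax)
open import Relation.Binary.PropositionalEquality using (_≡_)
open import Relation.Nullary using (¬_)

record SimpleGraph (n : ℕ) : Set where
  field
    Adj   : Fin n → Fin n → Bool
    sym   : ∀ x y → Adj x y ≡ Adj y x
    loopless : ∀ x → Adj x x ≡ false

open SimpleGraph public

_~[_]_ : {n : ℕ} → Fin n → SimpleGraph n → Fin n → Set
x ~[ G ] y = Adj G x y ≡ true

HasEdge : {n : ℕ} → SimpleGraph n → Set
HasEdge G = ∃[ x ] ∃[ y ] (x ~[ G ] y)

-- Given blue set B, WhiteConn G B x y: x and y are white and lie in the same
-- connected component of G - B (there is a path from x to y through white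
-- vertices only).
data WhiteConn {n : ℕ} (G : SimpleGraph n) (B : Subset n) : Fin n → Fin n → Set where
  wc-refl : ∀ {x} → x ∉ B → WhiteConn G B x x
  wc-step : ∀ {x y z} → WhiteConn G B x y → y ~[ G ] z → z ∉ B → WhiteConn G B x z

-- PSD force u → w with current blue set B: u blue, w white neighbour of u,
-- and w is the unique white neighbour of u in G[B ∪ W], W the component of
-- G - B containing w.
PSDForce : {n : ℕ} → SimpleGraph n → Subset n → Fin n → Fin n → Set
PSDForce G B u w =
  (u ∈ B) × (w ∉ B) × (u ~[ G ] w) ×
  (∀ v → WhiteConn G B w v → u ~[ G ] v → v ≡ w)

OnlyWhiteNeighbour : {n : ℕ} → SimpleGraph n → Subset n → Fin n → Fin n → Set
OnlyWhiteNeighbour G B u w = ∀ v → u ~[ G ] v → v ∉ B → v ≡ w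

data PSDProcess {n : ℕ} (G : SimpleGraph n) : Subset n → Set where
  done  : ∀ {B} → (∀ x → x ∈ B) → PSDProcess G B
  force : ∀ {B} u w → PSDForce G B u w → PSDProcess G (B ∪ ⁅ w ⁆) → PSDProcess G B

IsPSDZFS : {n : ℕ} → SimpleGraph n → Subset n → Set
IsPSDZFS G B = PSDProcess G B

IsMinPSDZFS : {n : ℕ} → SimpleGraph n → Subset n → Set
IsMinPSDZFS G B = IsPSDZFS G B × (∀ B' → IsPSDZFS G B' → ∣ B ∣ ≤ ∣ B' ∣)

-- Start from a minimum PSD zero forcing set B whose process begins with a
-- force u → w, and let B' = (B − u) ∪ {w}, which is no larger than B.  If w has
-- no white neighbour, then w → u is a force from B' that needs no disconnect
-- rule, and B' ∪ {u} ⊇ B finishes the process.  Otherwise let W be the white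
-- component of w and D = (B − u) ∪ W.  D is a PSD zero forcing set (w forces u
-- and then D ∪ {u} ⊇ B), every vertex of D with a neighbour outside D lies in
-- B ∪ {w}, and replaying the process of B ∪ {w} inside D shows that
-- (B ∪ {w}) ∩ D = B' forces D.  So B' is again minimum; the first force of that
-- replay lands in W − w, and the white component of its target with respect
-- to B' lies in W − w.  Iterating, the white component shrinks until the first
-- case applies.
module Submission where

open import Defs
open import Data.Nat using (ℕ; zero; suc; _≤_; _<_; z≤n; s≤s; s≤s⁻¹; _+_)
open import Data.Nat.Properties
  using (≤-refl; ≤-trans; ≤-reflexive; <-≤-trans; n≤1+n; +-suc; +-comm; +-monoʳ-≤; ≰⇒>; <⇒≱; _≤?_)
open import Data.Bool using (true)
import Data.Bool.Properties as Bool
open import Data.Fin using (Fin)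
open import Data.Fin.Properties using (_≟_; any?; all?)
open import Data.Fin.Subset
  using (Subset; _∈_; _∉_; _⊆_; _⊂_; _∪_; _∩_; _─_; _-_; ⁅_⁆; ∁; ⊤; ∣_∣; inside; outside)
open import Data.Fin.Subset.Properties
open import Data.Vec using ([]; _∷_; here; there; tabulate)
open import Data.Vec.Properties using (lookup∘tabulate; []=⇒lookup; lookup⇒[]=)
open import Data.Product using (∃; _×_; ∃-syntax; _,_; proj₁; proj₂)
open import Data.Sum using (_⊎_; inj₁; inj₂; [_,_]′)
open import Function using (id; _∘_)
open import Relation.Binary.PropositionalEquality
  using (_≡_; _≢_; refl; trans; subst; cong) renaming (sym to ≡-sym)
open import Relation.Nullary using (¬_; Dec; yes; no; does; contradiction)
open import Relation.Nullary.Decidable using (_×-dec_; _→-dec_; ¬?; map′; dec-true)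
open import Relation.Unary using (Pred; Decidable)

private variable n : ℕ

x∈p─q⇒x∉q : ∀ {x : Fin n} (p q : Subset n) → x ∈ p ─ q → x ∉ q
x∈p─q⇒x∉q (_ ∷ p) (outside ∷ q) here         = λ ()
x∈p─q⇒x∉q (_ ∷ p) (_       ∷ q) (there x∈p─q) = λ { (there x∈q) → x∈p─q⇒x∉q p q x∈p─q x∈q }

x∈p-y⇒x≢y : ∀ {x y : Fin n} (p : Subset n) → x ∈ p - y → x ≢ y
x∈p-y⇒x≢y {y = y} p x∈p-y refl = x∈p─q⇒x∉q p ⁅ y ⁆ x∈p-y (x∈⁅x⁆ y)

x∈p∧x∉p-y⇒x≡y : ∀ {x y : Fin n} {p : Subset n} → x ∈ p → x ∉ p - y → x ≡ y
x∈p∧x∉p-y⇒x≡y {x = x} {y = y} x∈p x∉p-y with x ≟ y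
... | yes x≡y = x≡y
... | no x≢y  = contradiction (x∈p∧x≢y⇒x∈p-y x∈p x≢y) x∉p-y

x∉p∧x∉q⇒x∉p∪q : ∀ {x : Fin n} {p q : Subset n} → x ∉ p → x ∉ q → x ∉ p ∪ q
x∉p∧x∉q⇒x∉p∪q {p = p} {q = q} x∉p x∉q x∈p∪q = [ x∉p , x∉q ]′ (x∈p∪q⁻ p q x∈p∪q)

∪-lub : ∀ {p q r : Subset n} → p ⊆ r → q ⊆ r → p ∪ q ⊆ r
∪-lub {p = p} {q = q} p⊆r q⊆r x∈p∪q = [ p⊆r , q⊆r ]′ (x∈p∪q⁻ p q x∈p∪q)

p⊆p-x∪⁅x⁆ : ∀ (p : Subset n) x → p ⊆ (p - x) ∪ ⁅ x ⁆
p⊆p-x∪⁅x⁆ p x {y} y∈p with y ≟ x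
... | yes refl = q⊆p∪q (p - x) ⁅ x ⁆ (x∈⁅x⁆ x)
... | no y≢x   = p⊆p∪q ⁅ x ⁆ (x∈p∧x≢y⇒x∈p-y y∈p y≢x)

[p∪⁅x⁆]∩q≡p∩q : ∀ {x} (p q : Subset n) → x ∉ q → (p ∪ ⁅ x ⁆) ∩ q ≡ p ∩ q
[p∪⁅x⁆]∩q≡p∩q {x = x} p q x∉q = ⊆-antisym ⊆p∩q (λ y∈p∩q → let (y∈p , y∈q) = x∈p∩q⁻ p q y∈p∩q
                                                     in x∈p∩q⁺ (p⊆p∪q ⁅ x ⁆ y∈p , y∈q))
  where
  ⊆p∩q : (p ∪ ⁅ x ⁆) ∩ q ⊆ p ∩ q
  ⊆p∩q y∈ with x∈p∩q⁻ (p ∪ ⁅ x ⁆) q y∈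
  ... | y∈p∪⁅x⁆ , y∈q with x∈p∪q⁻ p ⁅ x ⁆ y∈p∪⁅x⁆
  ...   | inj₁ y∈p   = x∈p∩q⁺ (y∈p , y∈q)
  ...   | inj₂ y∈⁅x⁆ = contradiction (subst (_∈ q) (x∈⁅y⁆⇒x≡y x y∈⁅x⁆) y∈q) x∉q

[p∪r]∩q⊆[p∩q]∪r : ∀ (p q r : Subset n) → (p ∪ r) ∩ q ⊆ (p ∩ q) ∪ r
[p∪r]∩q⊆[p∩q]∪r p q r y∈ with x∈p∩q⁻ (p ∪ r) q y∈
... | y∈p∪r , y∈q = [ (λ y∈p → p⊆p∪q r (x∈p∩q⁺ (y∈p , y∈q))) , q⊆p∪q (p ∩ q) r ]′ (x∈p∪q⁻ p r y∈p∪r)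

∣p∪q∣≤∣p∣+∣q∣ : ∀ (p q : Subset n) → ∣ p ∪ q ∣ ≤ ∣ p ∣ + ∣ q ∣
∣p∪q∣≤∣p∣+∣q∣ []            []            = z≤n
∣p∪q∣≤∣p∣+∣q∣ (outside ∷ p) (outside ∷ q) = ∣p∪q∣≤∣p∣+∣q∣ p q
∣p∪q∣≤∣p∣+∣q∣ (outside ∷ p) (inside ∷ q)  = ≤-trans (s≤s (∣p∪q∣≤∣p∣+∣q∣ p q)) (≤-reflexive (≡-sym (+-suc ∣ p ∣ ∣ q ∣)))
∣p∪q∣≤∣p∣+∣q∣ (inside ∷ p)  (outside ∷ q) = s≤s (∣p∪q∣≤∣p∣+∣q∣ p q)
∣p∪q∣≤∣p∣+∣q∣ (inside ∷ p)  (inside ∷ q)  = s≤s (≤-trans (∣p∪q∣≤∣p∣+∣q∣ p q) (+-monoʳ-≤ ∣ p ∣ (n≤1+n ∣ q ∣)))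

∣p∪⁅x⁆∣≤1+∣p∣ : ∀ (p : Subset n) x → ∣ p ∪ ⁅ x ⁆ ∣ ≤ suc ∣ p ∣
∣p∪⁅x⁆∣≤1+∣p∣ p x = ≤-trans (∣p∪q∣≤∣p∣+∣q∣ p ⁅ x ⁆)
  (≤-reflexive (trans (cong (∣ p ∣ +_) (∣⁅x⁆∣≡1 x)) (+-comm ∣ p ∣ 1)))

∣p-x∪⁅y⁆∣≤∣p∣ : ∀ {x} (p : Subset n) y → x ∈ p → ∣ (p - x) ∪ ⁅ y ⁆ ∣ ≤ ∣ p ∣
∣p-x∪⁅y⁆∣≤∣p∣ {x = x} p y x∈p = ≤-trans (∣p∪⁅x⁆∣≤1+∣p∣ (p - x) y) (x∈p⇒∣p-x∣<∣p∣ x∈p)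

∣∁[p∪⁅x⁆]∣<∣∁p∣ : ∀ {x} (p : Subset n) → x ∉ p → ∣ ∁ (p ∪ ⁅ x ⁆) ∣ < ∣ ∁ p ∣
∣∁[p∪⁅x⁆]∣<∣∁p∣ {x = x} p x∉p = p⊂q⇒∣p∣<∣q∣
  ( (λ y∈∁ → x∉p⇒x∈∁p (x∈∁p⇒x∉p y∈∁ ∘ p⊆p∪q ⁅ x ⁆))
  , x , x∉p⇒x∈∁p x∉p , (λ x∈∁ → x∈∁p⇒x∉p x∈∁ (q⊆p∪q p ⁅ x ⁆ (x∈⁅x⁆ x))) )

∣p∣<1+n : ∀ (p : Subset n) → ∣ p ∣ < suc n
∣p∣<1+n p = s≤s (∣p∣≤n p)

subsetOf : ∀ {ℓ} {P : Pred (Fin n) ℓ} → Decidable P → Subset n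
subsetOf P? = tabulate (does ∘ P?)

module _ {ℓ} {P : Pred (Fin n) ℓ} (P? : Decidable P) where

  x∈subsetOf⁺ : ∀ {x} → P x → x ∈ subsetOf P?
  x∈subsetOf⁺ {x} Px = lookup⇒[]= x _ (trans (lookup∘tabulate _ x) (dec-true (P? x) Px))

  x∈subsetOf⁻ : ∀ {x} → x ∈ subsetOf P? → P x
  x∈subsetOf⁻ {x} x∈ with P? x | trans (≡-sym (lookup∘tabulate (does ∘ P?) x)) ([]=⇒lookup x∈)
  ... | yes Px | _ = Px
  ... | no _   | ()

∃-minimum : ∀ {ℓ} {P : Pred (Subset n) ℓ} → Decidable P → ∃ P →
            ∃[ p ] (P p × (∀ q → P q → ∣ p ∣ ≤ ∣ q ∣))
∃-minimum {P = P} P? (p , Pp) = go ∣ p ∣ p Pp ≤-refl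
  where
  go : ∀ k p → P p → ∣ p ∣ ≤ k → ∃[ p ] (P p × (∀ q → P q → ∣ p ∣ ≤ ∣ q ∣))
  go zero    p Pp ∣p∣≤0 = p , Pp , λ _ _ → ≤-trans ∣p∣≤0 z≤n
  go (suc k) p Pp ∣p∣≤k+1 with anySubset? (λ q → P? q ×-dec (∣ q ∣ ≤? k))
  ... | yes (q , Pq , ∣q∣≤k) = go k q Pq ∣q∣≤k
  ... | no ∄q = p , Pp , λ q Pq → ≤-trans ∣p∣≤k+1 (≰⇒> (λ ∣q∣≤k → ∄q (q , Pq , ∣q∣≤k)))

swap : ∀ {n} → Subset n → Fin n → Fin n → Subset n
swap B u w = (B - u) ∪ ⁅ w ⁆

module _ {n : ℕ} (G : SimpleGraph n) where

  ~-sym : ∀ {x y} → x ~[ G ] y → y ~[ G ] x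
  ~-sym {x} {y} x~y = trans (sym G y x) x~y

  ~⇒≢ : ∀ {x y} → x ~[ G ] y → x ≢ y
  ~⇒≢ {x} x~x refl = contradiction (trans (≡-sym x~x) (loopless G x)) λ ()

  _~?_ : ∀ x y → Dec (x ~[ G ] y)
  x ~? y = Adj G x y Bool.≟ true

  whiteConn-white : ∀ {B x y} → WhiteConn G B x y → y ∉ B
  whiteConn-white (wc-refl y∉B)     = y∉B
  whiteConn-white (wc-step _ _ y∉B) = y∉B

  whiteConn-antimono : ∀ {X Y x y} → X ⊆ Y → WhiteConn G Y x y → WhiteConn G X x y
  whiteConn-antimono X⊆Y (wc-refl x∉Y)       = wc-refl (x∉Y ∘ X⊆Y)
  whiteConn-antimono X⊆Y (wc-step c y~z z∉Y) = wc-step (whiteConn-antimono X⊆Y c) y~z (z∉Y ∘ X⊆Y)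

  whiteConn-avoid : ∀ {B x t} z → x ≢ z → WhiteConn G B x t →
                    WhiteConn G (B ∪ ⁅ z ⁆) x t ⊎ ∃[ y ] (y ~[ G ] z × WhiteConn G (B ∪ ⁅ z ⁆) x y)
  whiteConn-avoid z x≢z (wc-refl x∉B) = inj₁ (wc-refl (x∉p∧x∉q⇒x∉p∪q x∉B (x≢y⇒x∉⁅y⁆ x≢z)))
  whiteConn-avoid z x≢z (wc-step {z = t} c y~t t∉B) with whiteConn-avoid z x≢z c | t ≟ z
  ... | inj₂ entry | _        = inj₂ entry
  ... | inj₁ c′    | yes refl = inj₂ (_ , y~t , c′)
  ... | inj₁ c′    | no t≢z   = inj₁ (wc-step c′ y~t (x∉p∧x∉q⇒x∉p∪q t∉B (x≢y⇒x∉⁅y⁆ t≢z)))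

  whiteConn-lastEdge : ∀ {B x z} → x ≢ z → WhiteConn G B x z →
                       ∃[ y ] (y ~[ G ] z × WhiteConn G (B ∪ ⁅ z ⁆) x y)
  whiteConn-lastEdge {B} {z = z} x≢z c with whiteConn-avoid z x≢z c
  ... | inj₁ c′    = contradiction (q⊆p∪q B ⁅ z ⁆ (x∈⁅x⁆ z)) (whiteConn-white c′)
  ... | inj₂ entry = entry

  whiteConn? : ∀ B x z → Dec (WhiteConn G B x z)
  whiteConn? B = go (suc n) B (∣p∣<1+n (∁ B))
    where
    go : ∀ k B → ∣ ∁ B ∣ < k → ∀ x z → Dec (WhiteConn G B x z)
    go (suc k) B bound x z with z ∈? B | x ≟ z
    ... | yes z∈B | _        = no λ c → whiteConn-white c z∈B
    ... | no z∉B  | yes refl = yes (wc-refl z∉B)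
    ... | no z∉B  | no x≢z   =
      map′ (λ (y , y~z , c) → wc-step (whiteConn-antimono (p⊆p∪q ⁅ z ⁆) c) y~z z∉B)
           (whiteConn-lastEdge x≢z)
           (any? λ y → (y ~? z) ×-dec
                       go k (B ∪ ⁅ z ⁆) (<-≤-trans (∣∁[p∪⁅x⁆]∣<∣∁p∣ B z∉B) (s≤s⁻¹ bound)) x y)

  component : Subset n → Fin n → Subset n
  component B w = subsetOf (whiteConn? B w)

  component⁺ : ∀ {B w x} → WhiteConn G B w x → x ∈ component B w
  component⁺ {B} {w} = x∈subsetOf⁺ (whiteConn? B w)

  component⁻ : ∀ {B w x} → x ∈ component B w → WhiteConn G B w x
  component⁻ {B} {w} = x∈subsetOf⁻ (whiteConn? B w)

  psdForce? : ∀ B u w → Dec (PSDForce G B u w)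
  psdForce? B u w = (u ∈? B) ×-dec ¬? (w ∈? B) ×-dec (u ~? w) ×-dec
                    all? (λ v → whiteConn? B w v →-dec ((u ~? v) →-dec (v ≟ w)))

  psdProcess? : ∀ B → Dec (PSDProcess G B)
  psdProcess? B = go (suc n) B (∣p∣<1+n (∁ B))
    where
    go : ∀ k B → ∣ ∁ B ∣ < k → Dec (PSDProcess G B)
    go (suc k) B bound with all? (_∈? B)
    ... | yes all-blue = yes (done all-blue)
    ... | no ¬all-blue = map′ (λ (u , w , u→w , rest) → force u w u→w rest) firstStep
                              (any? λ u → any? λ w → step? u w)
      where
      firstStep : PSDProcess G B → ∃[ u ] ∃[ w ] (PSDForce G B u w × PSDProcess G (B ∪ ⁅ w ⁆))
      firstStep (done all-blue)      = contradiction all-blue ¬all-blue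
      firstStep (force u w u→w rest) = u , w , u→w , rest
      step? : ∀ u w → Dec (PSDForce G B u w × PSDProcess G (B ∪ ⁅ w ⁆))
      step? u w with psdForce? B u w
      ... | no ¬u→w = no (¬u→w ∘ proj₁)
      ... | yes u→w@(_ , w∉B , _) =
        map′ (u→w ,_) proj₂ (go k (B ∪ ⁅ w ⁆) (<-≤-trans (∣∁[p∪⁅x⁆]∣<∣∁p∣ B w∉B) (s≤s⁻¹ bound)))

  PSDForce-mono : ∀ {X Y a b} → X ⊆ Y → b ∉ Y → PSDForce G X a b → PSDForce G Y a b
  PSDForce-mono X⊆Y b∉Y (a∈X , _ , a~b , unique) =
    X⊆Y a∈X , b∉Y , a~b , λ v c → unique v (whiteConn-antimono X⊆Y c)

  PSDProcess-mono : ∀ {X Y} → X ⊆ Y → PSDProcess G X → PSDProcess G Y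
  PSDProcess-mono X⊆Y (done all-blue) = done (X⊆Y ∘ all-blue)
  PSDProcess-mono {Y = Y} X⊆Y (force a b a→b rest) with b ∈? Y
  ... | yes b∈Y = PSDProcess-mono (∪-lub X⊆Y (λ b′∈⁅b⁆ → subst (_∈ Y) (≡-sym (x∈⁅y⁆⇒x≡y b b′∈⁅b⁆)) b∈Y)) rest
  ... | no b∉Y  = force a b (PSDForce-mono X⊆Y b∉Y a→b)
                    (PSDProcess-mono (∪-lub (p⊆p∪q ⁅ b ⁆ ∘ X⊆Y) (q⊆p∪q Y ⁅ b ⁆)) rest)

  only⇒PSDForce : ∀ {B u w} → u ∈ B → w ∉ B → u ~[ G ] w →
                  OnlyWhiteNeighbour G B u w → PSDForce G B u w
  only⇒PSDForce u∈B w∉B u~w only = u∈B , w∉B , u~w , λ v c u~v → only v u~v (whiteConn-white c)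

  ∂_⊆_ : Subset n → Subset n → Set
  ∂ D ⊆ Z = ∀ {y z} → y ∈ D → z ∉ D → y ~[ G ] z → y ∈ Z

  ∂-mono : ∀ {D Z Z′} → Z ⊆ Z′ → ∂ D ⊆ Z → ∂ D ⊆ Z′
  ∂-mono Z⊆Z′ ∂D⊆Z y∈D z∉D y~z = Z⊆Z′ (∂D⊆Z y∈D z∉D y~z)

  whiteConn-confined : ∀ {D Z b v} → ∂ D ⊆ Z → b ∈ D → WhiteConn G (Z ∩ D) b v →
                       WhiteConn G Z b v × v ∈ D
  whiteConn-confined ∂D⊆Z b∈D (wc-refl b∉Z∩D) = wc-refl (λ b∈Z → b∉Z∩D (x∈p∩q⁺ (b∈Z , b∈D))) , b∈D
  whiteConn-confined {D} ∂D⊆Z b∈D (wc-step {z = z} c y~z z∉Z∩D)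
    with whiteConn-confined ∂D⊆Z b∈D c | z ∈? D
  ... | c′ , y∈D | yes z∈D = wc-step c′ y~z (λ z∈Z → z∉Z∩D (x∈p∩q⁺ (z∈Z , z∈D))) , z∈D
  ... | c′ , y∈D | no z∉D  = contradiction (∂D⊆Z y∈D z∉D y~z) (whiteConn-white c′)

  PSDForce-∩ : ∀ {D Z a b} → ∂ D ⊆ Z → b ∈ D → PSDForce G Z a b → PSDForce G (Z ∩ D) a b
  PSDForce-∩ {D} {Z} {a} ∂D⊆Z b∈D (a∈Z , b∉Z , a~b , unique) with a ∈? D
  ... | no a∉D  = contradiction (∂D⊆Z b∈D a∉D (~-sym a~b)) b∉Z
  ... | yes a∈D = x∈p∩q⁺ (a∈Z , a∈D) , b∉Z ∘ p∩q⊆p Z D , a~b ,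
                  λ v c → unique v (proj₁ (whiteConn-confined ∂D⊆Z b∈D c))

  -- Replay the forces of Z's process that land in D; when it ends D is blue, and D's own process finishes.
  PSDProcess-∩ : ∀ {D Z} → ∂ D ⊆ Z → PSDProcess G Z → PSDProcess G D → PSDProcess G (Z ∩ D)
  PSDProcess-∩ ∂D⊆Z (done all-blue) D-process = PSDProcess-mono (λ x∈D → x∈p∩q⁺ (all-blue _ , x∈D)) D-process
  PSDProcess-∩ {D} {Z} ∂D⊆Z (force a b a→b rest) D-process
    with b ∈? D | PSDProcess-∩ (∂-mono (p⊆p∪q ⁅ b ⁆) ∂D⊆Z) rest D-process
  ... | no b∉D  | replay = subst (PSDProcess G) ([p∪⁅x⁆]∩q≡p∩q Z D b∉D) replay
  ... | yes b∈D | replay =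
    force a b (PSDForce-∩ ∂D⊆Z b∈D a→b) (PSDProcess-mono ([p∪r]∩q⊆[p∩q]∪r Z D ⁅ b ⁆) replay)

  firstForceInto : ∀ {D Z} → ∂ D ⊆ Z → PSDProcess G Z →
                   D ⊆ Z ⊎ ∃[ a ] ∃[ b ] (b ∈ D × PSDForce G (Z ∩ D) a b)
  firstForceInto ∂D⊆Z (done all-blue) = inj₁ (λ _ → all-blue _)
  firstForceInto {D} {Z} ∂D⊆Z (force a b a→b rest) with b ∈? D
  ... | yes b∈D = inj₂ (a , b , b∈D , PSDForce-∩ ∂D⊆Z b∈D a→b)
  ... | no b∉D with firstForceInto (∂-mono (p⊆p∪q ⁅ b ⁆) ∂D⊆Z) rest
  ...   | inj₁ D⊆Z∪b = inj₁ λ y∈D →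
            p∩q⊆p Z D (subst (_ ∈_) ([p∪⁅x⁆]∩q≡p∩q Z D b∉D) (x∈p∩q⁺ (D⊆Z∪b y∈D , y∈D)))
  ...   | inj₂ (a′ , b′ , b′∈D , a′→b′) =
            inj₂ (a′ , b′ , b′∈D , subst (λ X → PSDForce G X a′ b′) ([p∪⁅x⁆]∩q≡p∩q Z D b∉D) a′→b′)

  minimumPSDZFS : ∃[ B ] IsMinPSDZFS G B
  minimumPSDZFS = ∃-minimum psdProcess? (⊤ , done (λ _ → ∈⊤))

  ∁⁅y⁆-isPSDZFS : ∀ {x y} → x ~[ G ] y → IsPSDZFS G (∁ ⁅ y ⁆)
  ∁⁅y⁆-isPSDZFS {x} {y} x~y = force x y x→y (done all-blue)
    where
    x→y : PSDForce G (∁ ⁅ y ⁆) x y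
    x→y = only⇒PSDForce (x∉p⇒x∈∁p (x≢y⇒x∉⁅y⁆ (~⇒≢ x~y))) (x∈p⇒x∉∁p (x∈⁅x⁆ y)) x~y
                        (λ v _ v∉∁⁅y⁆ → x∈⁅y⁆⇒x≡y y (x∉∁p⇒x∈p v∉∁⁅y⁆))
    all-blue : ∀ z → z ∈ ∁ ⁅ y ⁆ ∪ ⁅ y ⁆
    all-blue z with z ∈? ⁅ y ⁆
    ... | yes z∈⁅y⁆ = q⊆p∪q (∁ ⁅ y ⁆) ⁅ y ⁆ z∈⁅y⁆
    ... | no z∉⁅y⁆  = p⊆p∪q ⁅ y ⁆ (x∉p⇒x∈∁p z∉⁅y⁆)

  minimum-hasForce : ∀ {B} → HasEdge G → IsMinPSDZFS G B → ∃[ u ] ∃[ w ] PSDForce G B u w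
  minimum-hasForce _ (force u w u→w _ , _) = u , w , u→w
  minimum-hasForce {B} (x , y , x~y) (done all-blue , minimal) =
    contradiction (minimal _ (∁⁅y⁆-isPSDZFS x~y)) (<⇒≱ (p⊂q⇒∣p∣<∣q∣ ∁⁅y⁆⊂B))
    where
    ∁⁅y⁆⊂B : ∁ ⁅ y ⁆ ⊂ B
    ∁⁅y⁆⊂B = (λ {z} _ → all-blue z) , y , all-blue y , x∈p⇒x∉∁p (x∈⁅x⁆ y)

  StandardFirstForce : Subset n → Fin n → Fin n → Set
  StandardFirstForce B u w = PSDForce G B u w × OnlyWhiteNeighbour G B u w × PSDProcess G (B ∪ ⁅ w ⁆)

  reversedForce : ∀ {B X u w} → u ~[ G ] w → B - u ⊆ X → w ∈ X → u ∉ X →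
                  (∀ {v} → w ~[ G ] v → v ∉ B → v ∈ X) → PSDProcess G B →
                  StandardFirstForce X w u
  reversedForce {B} {X} {u} {w} u~w B-u⊆X w∈X u∉X whiteNeighbours⊆X B-process =
    only⇒PSDForce w∈X u∉X (~-sym u~w) only , only ,
    PSDProcess-mono (⊆-trans (p⊆p-x∪⁅x⁆ B u) (∪-lub (p⊆p∪q ⁅ u ⁆ ∘ B-u⊆X) (q⊆p∪q X ⁅ u ⁆))) B-process
    where
    only : OnlyWhiteNeighbour G X w u
    only v w~v v∉X with v ∈? B
    ... | yes v∈B = x∈p∧x∉p-y⇒x≡y v∈B (v∉X ∘ B-u⊆X)
    ... | no v∉B  = contradiction (whiteNeighbours⊆X w~v v∉B) v∉X

  module _ {B : Subset n} {u w : Fin n} (u→w : PSDForce G B u w) where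

    private
      u∈B : u ∈ B
      u∈B = proj₁ u→w

      w∉B : w ∉ B
      w∉B = proj₁ (proj₂ u→w)

      u~w : u ~[ G ] w
      u~w = proj₁ (proj₂ (proj₂ u→w))

      onlyNeighbourInComponent : ∀ {v} → WhiteConn G B w v → u ~[ G ] v → v ≡ w
      onlyNeighbourInComponent = proj₂ (proj₂ (proj₂ u→w)) _

      W D Z : Subset n
      W = component B w
      D = (B - u) ∪ W
      Z = B ∪ ⁅ w ⁆

      w∈W : w ∈ W
      w∈W = component⁺ (wc-refl w∉B)

      whiteNeighbour∈W : ∀ {y z} → y ∈ W → y ~[ G ] z → z ∉ B → z ∈ W
      whiteNeighbour∈W y∈W y~z z∉B = component⁺ (wc-step (component⁻ y∈W) y~z z∉B)

      u∉B-u : u ∉ B - u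
      u∉B-u u∈B-u = x∈p-y⇒x≢y B u∈B-u refl

      w∈swap : w ∈ swap B u w
      w∈swap = q⊆p∪q (B - u) ⁅ w ⁆ (x∈⁅x⁆ w)

    ∂D⊆Z : ∂ D ⊆ Z
    ∂D⊆Z {z = z} y∈D z∉D y~z with x∈p∪q⁻ (B - u) W y∈D
    ... | inj₁ y∈B-u = p⊆p∪q ⁅ w ⁆ (p─q⊆p B ⁅ u ⁆ y∈B-u)
    ... | inj₂ y∈W with z ∈? B
    ...   | no z∉B  = contradiction (q⊆p∪q (B - u) W (whiteNeighbour∈W y∈W y~z z∉B)) z∉D
    ...   | yes z∈B with x∈p∧x∉p-y⇒x≡y z∈B (z∉D ∘ p⊆p∪q W)
    ...     | refl with onlyNeighbourInComponent (component⁻ y∈W) (~-sym y~z)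
    ...       | refl = q⊆p∪q B ⁅ w ⁆ (x∈⁅x⁆ w)

    D-isPSDZFS : PSDProcess G B → PSDProcess G D
    D-isPSDZFS B-process =
      let (w→u , _ , rest) = reversedForce u~w (p⊆p∪q W) (q⊆p∪q (B - u) W w∈W) u∉D
                                            (λ w~v v∉B → q⊆p∪q (B - u) W (whiteNeighbour∈W w∈W w~v v∉B))
                                            B-process
      in force w u w→u rest
      where
      u∉D : u ∉ D
      u∉D = x∉p∧x∉q⇒x∉p∪q u∉B-u (λ u∈W → whiteConn-white (component⁻ u∈W) u∈B)

    Z∩D≡swap : Z ∩ D ≡ swap B u w
    Z∩D≡swap = ⊆-antisym Z∩D⊆swap swap⊆Z∩D
      where
      Z∩D⊆swap : Z ∩ D ⊆ swap B u w
      Z∩D⊆swap y∈Z∩D with x∈p∩q⁻ Z D y∈Z∩D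
      ... | y∈Z , y∈D with x∈p∪q⁻ (B - u) W y∈D
      ...   | inj₁ y∈B-u = p⊆p∪q ⁅ w ⁆ y∈B-u
      ...   | inj₂ y∈W   = q⊆p∪q (B - u) ⁅ w ⁆
              ([ (λ y∈B → contradiction y∈B (whiteConn-white (component⁻ y∈W))) , id ]′ (x∈p∪q⁻ B ⁅ w ⁆ y∈Z))
      swap⊆Z∩D : swap B u w ⊆ Z ∩ D
      swap⊆Z∩D y∈swap with x∈p∪q⁻ (B - u) ⁅ w ⁆ y∈swap
      ... | inj₁ y∈B-u = x∈p∩q⁺ (p⊆p∪q ⁅ w ⁆ (p─q⊆p B ⁅ u ⁆ y∈B-u) , p⊆p∪q W y∈B-u)
      ... | inj₂ y∈⁅w⁆ with x∈⁅y⁆⇒x≡y w y∈⁅w⁆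
      ...   | refl = x∈p∩q⁺ (q⊆p∪q B ⁅ w ⁆ y∈⁅w⁆ , q⊆p∪q (B - u) W w∈W)

    swap-isPSDZFS : PSDProcess G B → PSDProcess G (swap B u w)
    swap-isPSDZFS B-process = subst (PSDProcess G) Z∩D≡swap
      (PSDProcess-∩ ∂D⊆Z (PSDProcess-mono (p⊆p∪q ⁅ w ⁆) B-process) (D-isPSDZFS B-process))

    swap-isMinPSDZFS : IsMinPSDZFS G B → IsMinPSDZFS G (swap B u w)
    swap-isMinPSDZFS (B-process , minimal) =
      swap-isPSDZFS B-process , λ B′ B′-process → ≤-trans (∣p-x∪⁅y⁆∣≤∣p∣ B w u∈B) (minimal B′ B′-process)

    swap-standardForce : PSDProcess G B → (∀ x → w ~[ G ] x → x ∈ B) → StandardFirstForce (swap B u w) w u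
    swap-standardForce B-process noWhiteNeighbour =
      reversedForce u~w (p⊆p∪q ⁅ w ⁆) w∈swap
                    (x∉p∧x∉q⇒x∉p∪q u∉B-u (x≢y⇒x∉⁅y⁆ (~⇒≢ u~w)))
                    (λ {v} w~v v∉B → contradiction (noWhiteNeighbour v w~v) v∉B)
                    B-process

    whiteConn-swap : ∀ {s y} → WhiteConn G B w s → WhiteConn G (swap B u w) s y → WhiteConn G B w y
    whiteConn-swap w⇝s (wc-refl _) = w⇝s
    whiteConn-swap w⇝s (wc-step {z = z} s⇝y y~z z∉swap) with z ∈? B
    ... | no z∉B  = wc-step (whiteConn-swap w⇝s s⇝y) y~z z∉B
    ... | yes z∈B with x∈p∧x∉p-y⇒x≡y z∈B (z∉swap ∘ p⊆p∪q ⁅ w ⁆)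
    ...   | refl with onlyNeighbourInComponent (whiteConn-swap w⇝s s⇝y) (~-sym y~z)
    ...     | refl = contradiction w∈swap (whiteConn-white s⇝y)

    component-swap-⊂ : ∀ {b} → WhiteConn G B w b → component (swap B u w) b ⊂ component B w
    component-swap-⊂ w⇝b =
      (λ y∈ → component⁺ (whiteConn-swap w⇝b (component⁻ y∈))) ,
      w , w∈W , λ w∈ → whiteConn-white (component⁻ w∈) w∈swap

    swap-forces-smallerComponent : PSDProcess G B → ¬ (∀ x → w ~[ G ] x → x ∈ B) →
      ∃[ a ] ∃[ b ] (PSDForce G (swap B u w) a b × ∣ component (swap B u w) b ∣ < ∣ component B w ∣)
    swap-forces-smallerComponent B-process hasWhiteNeighbour
      with firstForceInto ∂D⊆Z (PSDProcess-mono (p⊆p∪q ⁅ w ⁆) B-process)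
    ... | inj₁ D⊆Z = contradiction noWhiteNeighbour hasWhiteNeighbour
      where
      noWhiteNeighbour : ∀ x → w ~[ G ] x → x ∈ B
      noWhiteNeighbour x w~x with x ∈? B
      ... | yes x∈B = x∈B
      ... | no x∉B  = [ id , (λ x∈⁅w⁆ → contradiction (x∈⁅y⁆⇒x≡y w x∈⁅w⁆) (~⇒≢ (~-sym w~x))) ]′
                        (x∈p∪q⁻ B ⁅ w ⁆ (D⊆Z (q⊆p∪q (B - u) W (whiteNeighbour∈W w∈W w~x x∉B))))
    ... | inj₂ (a , b , b∈D , a→b) = a , b , a→b′ , p⊂q⇒∣p∣<∣q∣ (component-swap-⊂ w⇝b)
      where
      a→b′ : PSDForce G (swap B u w) a b
      a→b′ = subst (λ X → PSDForce G X a b) Z∩D≡swap a→b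
      w⇝b : WhiteConn G B w b
      w⇝b = [ (λ b∈B-u → contradiction (p⊆p∪q ⁅ w ⁆ b∈B-u) (proj₁ (proj₂ a→b′))) , component⁻ ]′
              (x∈p∪q⁻ (B - u) W b∈D)

  minimum⇒standardFirstForce : ∀ k {B u w} → IsMinPSDZFS G B → PSDForce G B u w →
    ∣ component B w ∣ < k → ∃[ B′ ] (IsMinPSDZFS G B′ × ∃[ u′ ] ∃[ w′ ] StandardFirstForce B′ u′ w′)
  minimum⇒standardFirstForce (suc k) {B} {u} {w} isMin@(B-process , _) u→w bound
    with all? (λ x → (w ~? x) →-dec (x ∈? B))
  ... | yes noWhiteNeighbour =
    swap B u w , swap-isMinPSDZFS u→w isMin , w , u , swap-standardForce u→w B-process noWhiteNeighbour
  ... | no hasWhiteNeighbour =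
    let (a , b , a→b , shrinks) = swap-forces-smallerComponent u→w B-process hasWhiteNeighbour
    in minimum⇒standardFirstForce k (swap-isMinPSDZFS u→w isMin) a→b (<-≤-trans shrinks (s≤s⁻¹ bound))

theorem2p31 : ∀ {n : ℕ} (G : SimpleGraph n) → HasEdge G →
    ∃[ B ] (IsMinPSDZFS G B ×
      ∃[ u ] ∃[ w ] (PSDForce G B u w × OnlyWhiteNeighbour G B u w ×
                     PSDProcess G (B ∪ ⁅ w ⁆)))
theorem2p31 {n} G hasEdge =
  let (B , isMin) = minimumPSDZFS G
      (u , w , u→w) = minimum-hasForce G hasEdge isMin
  in minimum⇒standardFirstForce G (suc n) isMin u→w (∣p∣<1+n (component G B w))
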